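{- Let $B$ be a skew-symmetrizable matrix and let $A$ be a quasi-Cartan companion of $B$. If $A$ is positive, then for every chordless cycle $Z$ in $\Gamma(B)$, the product $\prod_{\{i,j\}\in Z}(-A_{ij})$ over all edges $\{i,j\}$ of $Z$ is negative.
   Context: All matrices are square integer matrices. $B$ is skew-symmetrizable if $DB$ is skew-symmetric for some diagonal $D$ with positive diagonal entries. A quasi-Cartan matrix $A$ is a matrix with all diagonal entries $2$ such that $DA$ is symmetric for some such $D$; it is positive if $DA$ is positive definite. A quasi-Cartan companion of $B$ is a quasi-Cartan matrix $A$ with $|A_{ij}|=|B_{ij}|$ for all $i\neq j$. $\Gamma(B)$ is the directed graph on the matrix indices with an arrow $i\to j$ whenever $B_{ij}>0$. A chordless cycle is an induced subgraph whose underlying undirected graph is a cycle of length at least $3$. -}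

module Defs where

open import Data.Nat as ℕ using (ℕ; zero; suc)
open import Data.Nat.DivMod using (_%_; m%n<n)
open import Data.Fin using (Fin; toℕ; fromℕ<) renaming (zero to fzero; suc to fsuc)
open import Data.Integer using (ℤ; +_; -_; _*_; _+_; _<_; ∣_∣; 0ℤ; 1ℤ)
open import Data.Product using (Σ; ∃; _×_; Σ-syntax)
open import Data.Sum using (_⊎_)
open import Relation.Binary.PropositionalEquality using (_≡_; _≢_)
open import Function.Definitions using (Injective)
open import Function.Bundles using (_⇔_)

Matrix : ℕ → Set
Matrix n = Fin n → Fin n → ℤ

∑ : ∀ {n} → (Fin n → ℤ) → ℤ
∑ {zero} f = 0ℤ
∑ {suc n} f = f fzero + ∑ (λ i → f (fsuc i))

∏ : ∀ {n} → (Fin n → ℤ) → ℤ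
∏ {zero} f = 1ℤ
∏ {suc n} f = f fzero * ∏ (λ i → f (fsuc i))

-- d is the diagonal of a diagonal matrix with positive diagonal entries
PositiveDiagonal : ∀ {n} → (Fin n → ℤ) → Set
PositiveDiagonal d = ∀ i → 0ℤ < d i

diagMul : ∀ {n} → (Fin n → ℤ) → Matrix n → Matrix n
diagMul d M i j = d i * M i j

IsSymmetric : ∀ {n} → Matrix n → Set
IsSymmetric M = ∀ i j → M i j ≡ M j i

IsSkewSymmetric : ∀ {n} → Matrix n → Set
IsSkewSymmetric M = ∀ i j → M i j ≡ - M j i

IsPositiveDefinite : ∀ {n} → Matrix n → Set
IsPositiveDefinite {n} M =
  (x : Fin n → ℤ) → (Σ[ i ∈ Fin n ] x i ≢ 0ℤ) → 0ℤ < ∑ (λ i → ∑ (λ j → x i * M i j * x j))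

IsSkewSymmetrizable : ∀ {n} → Matrix n → Set
IsSkewSymmetrizable {n} B =
  Σ[ d ∈ (Fin n → ℤ) ] PositiveDiagonal d × IsSkewSymmetric (diagMul d B)

IsQuasiCartan : ∀ {n} → Matrix n → Set
IsQuasiCartan {n} A =
  (∀ i → A i i ≡ + 2) ×
  (Σ[ d ∈ (Fin n → ℤ) ] PositiveDiagonal d × IsSymmetric (diagMul d A))

IsPositiveQuasiCartan : ∀ {n} → Matrix n → Set
IsPositiveQuasiCartan {n} A =
  (∀ i → A i i ≡ + 2) ×
  (Σ[ d ∈ (Fin n → ℤ) ] PositiveDiagonal d × IsSymmetric (diagMul d A)
                        × IsPositiveDefinite (diagMul d A))

IsQuasiCartanCompanion : ∀ {n} → Matrix n → Matrix n → Set
IsQuasiCartanCompanion A B =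
  IsQuasiCartan A × (∀ i j → i ≢ j → ∣ A i j ∣ ≡ ∣ B i j ∣)

-- Γ(B) has an arrow i → j iff B i j > 0
Arrow : ∀ {n} → Matrix n → Fin n → Fin n → Set
Arrow B i j = 0ℤ < B i j

Adjacent : ∀ {n} → Matrix n → Fin n → Fin n → Set
Adjacent B i j = Arrow B i j ⊎ Arrow B j i

sucMod : ∀ {k} → Fin (suc k) → Fin (suc k)
sucMod {k} a = fromℕ< (m%n<n (suc (toℕ a)) (suc k))

Consecutive : ∀ {k} → Fin (suc k) → Fin (suc k) → Set
Consecutive a b = b ≡ sucMod a ⊎ a ≡ sucMod b

-- A chordless cycle of length m+3 in Γ(B): distinct vertices v_0,…,v_{m+2}
-- such that the induced subgraph's underlying undirected graph is exactly
-- the cycle v_0 - v_1 - … - v_{m+2} - v_0.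
record ChordlessCycle {n : ℕ} (B : Matrix n) : Set where
  field
    m        : ℕ
    vertex   : Fin (3 ℕ.+ m) → Fin n
    distinct : Injective _≡_ _≡_ vertex
    induced  : ∀ a b → Adjacent B (vertex a) (vertex b) ⇔ Consecutive a b

cycleProduct : ∀ {n} {B : Matrix n} → Matrix n → ChordlessCycle B → ℤ
cycleProduct A Z = ∏ (λ a → - A (vertex a) (vertex (sucMod a)))
  where open ChordlessCycle Z

{-# OPTIONS --safe #-}
-- Suppose the product of the -A_ij around the chordless cycle Z were nonnegative.
-- Every edge of Z has A_ij ≠ 0 (|A_ij| = |B_ij| and B is skew-symmetrizable), so
-- there are signs ε_a = ±1 on the vertices making every ε_a ε_b A_ab on an edge
-- negative: propagate signs along the path v₀ … v_last; they close up consistently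
-- because the cycle product is nonnegative. Let x be ε on Z and 0 elsewhere. Since Z
-- is chordless, the row of xᵀ D A x at a vertex a of Z only sees a and its two
-- neighbours, and contributes at most d_a (2 - 1 - 1) = 0 (DA symmetric gives
-- d_a A_ab = d_b A_ba, so the edge signs agree in both directions). Hence
-- xᵀ D A x ≤ 0 with x ≠ 0, contradicting positivity.

module Submission where

open import Defs
open import Data.Nat as ℕ using (ℕ; zero; suc)
import Data.Nat.Properties as ℕ
open import Data.Nat.DivMod using (_%_; m<n⇒m%n≡m; n%n≡0)
open import Data.Fin using (Fin; toℕ; fromℕ; inject₁) renaming (zero to fzero; suc to fsuc)
open import Data.Fin.Properties using (_≟_; any?; 0≢1+n; suc-injective; toℕ-injective; toℕ-fromℕ; toℕ-fromℕ<; toℕ-inject₁; toℕ<n)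
open import Data.Fin.Relation.Unary.Top using (view; ‵fromℕ; ‵inject₁)
open import Data.Integer
  using (ℤ; +_; -[1+_]; -_; _*_; _+_; _<_; _≤_; _<?_; ∣_∣; sign; _◃_; 0ℤ; 1ℤ; -1ℤ; +<+; positive; nonNegative)
import Data.Integer.Properties as ℤ
open import Data.Integer.Tactic.RingSolver using (solve-∀)
open import Data.Product using (∃; _,_)
open import Data.Sum using (inj₁; inj₂)
open import Data.Empty using (⊥-elim)
open import Function.Base using (_∘_)
open import Function.Bundles using (Equivalence)
open import Function.Definitions using (Injective)
open import Relation.Binary.Definitions using (tri<; tri≈; tri>)
open import Relation.Binary.PropositionalEquality
open import Relation.Nullary using (¬_; Dec; yes; no)

private
  variable
    n k : ℕ
    c e i j : ℤ

pos*pos⇒pos : 0ℤ < i → 0ℤ < j → 0ℤ < i * j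
pos*pos⇒pos {i} 0<i 0<j = subst (_< i * _) (ℤ.*-zeroʳ i) (ℤ.*-monoˡ-<-pos i {{positive 0<i}} 0<j)

pos*neg≤neg : 0ℤ < c → i < 0ℤ → c * i ≤ - c
pos*neg≤neg {c} {i} 0<c i<0 = begin
  c * i     ≤⟨ ℤ.*-monoˡ-≤-nonNeg c {{nonNegative (ℤ.<⇒≤ 0<c)}} (ℤ.i<j⇒i≤pred[j] i<0) ⟩
  c * -1ℤ   ≡⟨ ℤ.*-comm c -1ℤ ⟩
  -1ℤ * c   ≡⟨ ℤ.-1*i≡-i c ⟩
  - c       ∎
  where open ℤ.≤-Reasoning

*-pos-≡⇒neg : 0ℤ < c → 0ℤ < e → c * i ≡ e * j → j < 0ℤ → i < 0ℤ
*-pos-≡⇒neg {c} {e} {i} {j} 0<c 0<e ci≡ej j<0 =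
  ℤ.*-cancelˡ-<-nonNeg c {{nonNegative (ℤ.<⇒≤ 0<c)}} (begin-strict
    c * i    ≡⟨ ci≡ej ⟩
    e * j    <⟨ ℤ.*-monoˡ-<-pos e {{positive 0<e}} j<0 ⟩
    e * 0ℤ   ≡⟨ ℤ.*-zeroʳ e ⟩
    0ℤ       ≡⟨ ℤ.*-zeroʳ c ⟨
    c * 0ℤ   ∎)
  where open ℤ.≤-Reasoning

≢0⇒0<∣∣ : i ≢ 0ℤ → 0ℤ < + ∣ i ∣
≢0⇒0<∣∣ i≢0 = +<+ (ℕ.n≢0⇒n>0 (i≢0 ∘ ℤ.∣i∣≡0⇒i≡0))

-- ±1 according to the sign of i, with σ 0ℤ = 1ℤ.
σ : ℤ → ℤ
σ i = sign i ◃ 1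

σ-unit : ∀ i → σ i * σ i ≡ 1ℤ
σ-unit (+ _)    = refl
σ-unit -[1+ _ ] = refl

σ*i≡∣i∣ : ∀ i → σ i * i ≡ + ∣ i ∣
σ*i≡∣i∣ (+ m)    = ℤ.*-identityˡ (+ m)
σ*i≡∣i∣ -[1+ m ] = ℤ.-1*i≡-i -[1+ m ]

unit*pos⇒1 : e * e ≡ 1ℤ → 0ℤ < e * i → ¬ i < 0ℤ → e ≡ 1ℤ
unit*pos⇒1 {+ 1}            _  _    _    = refl
unit*pos⇒1 {+ 0}            ()
unit*pos⇒1 {+ suc (suc _)}  ()
unit*pos⇒1 { -[1+ suc _ ]}  ()
unit*pos⇒1 { -[1+ 0 ]} {i} _ 0<-i ¬i<0 =
  ⊥-elim (¬i<0 (ℤ.neg-cancel-< (subst (0ℤ <_) (ℤ.-1*i≡-i i) 0<-i)))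

∑-mono-≤ : {f g : Fin n → ℤ} → (∀ j → f j ≤ g j) → ∑ f ≤ ∑ g
∑-mono-≤ {zero}  f≤g = ℤ.≤-refl
∑-mono-≤ {suc n} f≤g = ℤ.+-mono-≤ (f≤g fzero) (∑-mono-≤ (f≤g ∘ fsuc))

∑-nonpos : {f : Fin n → ℤ} → (∀ j → f j ≤ 0ℤ) → ∑ f ≤ 0ℤ
∑-nonpos {zero}  f≤0 = ℤ.≤-refl
∑-nonpos {suc n} f≤0 = ℤ.+-mono-≤ (f≤0 fzero) (∑-nonpos (f≤0 ∘ fsuc))

∑-zero : {f : Fin n → ℤ} → (∀ j → f j ≡ 0ℤ) → ∑ f ≡ 0ℤ
∑-zero {zero}  f≡0 = refl
∑-zero {suc n} f≡0 = cong₂ _+_ (f≡0 fzero) (∑-zero (f≡0 ∘ fsuc))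

∑-distrib-+ : (f g : Fin n → ℤ) → ∑ (λ j → f j + g j) ≡ ∑ f + ∑ g
∑-distrib-+ {zero}  f g = refl
∑-distrib-+ {suc n} f g = begin
  f fzero + g fzero + ∑ (λ j → f (fsuc j) + g (fsuc j))
    ≡⟨ cong (_+_ (f fzero + g fzero)) (∑-distrib-+ (f ∘ fsuc) (g ∘ fsuc)) ⟩
  f fzero + g fzero + (∑ (f ∘ fsuc) + ∑ (g ∘ fsuc))
    ≡⟨ interchange (f fzero) (g fzero) (∑ (f ∘ fsuc)) (∑ (g ∘ fsuc)) ⟩
  f fzero + ∑ (f ∘ fsuc) + (g fzero + ∑ (g ∘ fsuc)) ∎
  where
  open ≡-Reasoning
  interchange : ∀ a b c d → a + b + (c + d) ≡ a + c + (b + d)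
  interchange = solve-∀

∏-pos : {f : Fin n → ℤ} → (∀ j → 0ℤ < f j) → 0ℤ < ∏ f
∏-pos {zero}  0<f = +<+ (ℕ.s≤s ℕ.z≤n)
∏-pos {suc n} 0<f = pos*pos⇒pos (0<f fzero) (∏-pos (0<f ∘ fsuc))

δ : Fin n → Fin n → ℤ
δ fzero    fzero    = 1ℤ
δ fzero    (fsuc _) = 0ℤ
δ (fsuc _) fzero    = 0ℤ
δ (fsuc i) (fsuc j) = δ i j

δ-refl : (i : Fin n) → δ i i ≡ 1ℤ
δ-refl fzero    = refl
δ-refl (fsuc i) = δ-refl i

δ-≢ : {i j : Fin n} → i ≢ j → δ i j ≡ 0ℤ
δ-≢ {i = fzero}  {fzero}  i≢j = ⊥-elim (i≢j refl)
δ-≢ {i = fzero}  {fsuc _} i≢j = refl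
δ-≢ {i = fsuc _} {fzero}  i≢j = refl
δ-≢ {i = fsuc i} {fsuc j} i≢j = δ-≢ (i≢j ∘ cong fsuc)

∑-δ : ∀ c (i : Fin n) → ∑ (λ j → c * δ i j) ≡ c
∑-δ {suc n} c fzero = begin
  c * 1ℤ + ∑ {n} (λ _ → c * 0ℤ) ≡⟨ cong₂ _+_ (ℤ.*-identityʳ c) (∑-zero {n} (λ _ → ℤ.*-zeroʳ c)) ⟩
  c + 0ℤ                        ≡⟨ ℤ.+-identityʳ c ⟩
  c                             ∎
  where open ≡-Reasoning
∑-δ {suc n} c (fsuc i) = begin
  c * 0ℤ + ∑ (λ j → c * δ i j) ≡⟨ cong₂ _+_ (ℤ.*-zeroʳ c) (∑-δ c i) ⟩
  0ℤ + c                       ≡⟨ ℤ.+-identityˡ c ⟩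
  c                            ∎
  where open ≡-Reasoning

∑-≤-three-points : {f : Fin n → ℤ} {p q r : Fin n} {α β γ : ℤ} →
  p ≢ q → p ≢ r → q ≢ r → f p ≤ α → f q ≤ β → f r ≤ γ →
  (∀ j → j ≢ p → j ≢ q → j ≢ r → f j ≤ 0ℤ) → ∑ f ≤ α + β + γ
∑-≤-three-points {n} {f} {p} {q} {r} {α} {β} {γ} p≢q p≢r q≢r fp≤α fq≤β fr≤γ f≤0 = begin
  ∑ f
    ≤⟨ ∑-mono-≤ f≤g ⟩
  ∑ g
    ≡⟨ ∑-distrib-+ (λ j → α * δ p j + β * δ q j) (λ j → γ * δ r j) ⟩
  ∑ (λ j → α * δ p j + β * δ q j) + ∑ (λ j → γ * δ r j)
    ≡⟨ cong (_+ _) (∑-distrib-+ (λ j → α * δ p j) (λ j → β * δ q j)) ⟩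
  ∑ (λ j → α * δ p j) + ∑ (λ j → β * δ q j) + ∑ (λ j → γ * δ r j)
    ≡⟨ cong₂ _+_ (cong₂ _+_ (∑-δ α p) (∑-δ β q)) (∑-δ γ r) ⟩
  α + β + γ ∎
  where
  open ℤ.≤-Reasoning

  g : Fin n → ℤ
  g j = α * δ p j + β * δ q j + γ * δ r j

  g-weights : ∀ {j a b c} → δ p j ≡ a → δ q j ≡ b → δ r j ≡ c → g j ≡ α * a + β * b + γ * c
  g-weights refl refl refl = refl

  only-first : ∀ a b c → a * 1ℤ + b * 0ℤ + c * 0ℤ ≡ a
  only-first = solve-∀
  only-second : ∀ a b c → a * 0ℤ + b * 1ℤ + c * 0ℤ ≡ b
  only-second = solve-∀
  only-third : ∀ a b c → a * 0ℤ + b * 0ℤ + c * 1ℤ ≡ c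
  only-third = solve-∀
  none : ∀ a b c → a * 0ℤ + b * 0ℤ + c * 0ℤ ≡ 0ℤ
  none = solve-∀

  g-p : g p ≡ α
  g-p = trans (g-weights (δ-refl p) (δ-≢ (≢-sym p≢q)) (δ-≢ (≢-sym p≢r))) (only-first α β γ)
  g-q : g q ≡ β
  g-q = trans (g-weights (δ-≢ p≢q) (δ-refl q) (δ-≢ (≢-sym q≢r))) (only-second α β γ)
  g-r : g r ≡ γ
  g-r = trans (g-weights (δ-≢ p≢r) (δ-≢ q≢r) (δ-refl r)) (only-third α β γ)
  g-elsewhere : ∀ {j} → j ≢ p → j ≢ q → j ≢ r → g j ≡ 0ℤ
  g-elsewhere j≢p j≢q j≢r =
    trans (g-weights (δ-≢ (≢-sym j≢p)) (δ-≢ (≢-sym j≢q)) (δ-≢ (≢-sym j≢r))) (none α β γ)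

  f≤g : ∀ j → f j ≤ g j
  f≤g j with j ≟ p | j ≟ q | j ≟ r
  ... | yes refl | _        | _        = subst (f p ≤_) (sym g-p) fp≤α
  ... | no _     | yes refl | _        = subst (f q ≤_) (sym g-q) fq≤β
  ... | no _     | no _     | yes refl = subst (f r ≤_) (sym g-r) fr≤γ
  ... | no j≢p   | no j≢q   | no j≢r   =
    subst (f j ≤_) (sym (g-elsewhere j≢p j≢q j≢r)) (f≤0 j j≢p j≢q j≢r)

module _ {B : Matrix n} {i j : Fin n} where

  private
    rescaled-skew : (d : Fin n → ℤ) → IsSkewSymmetric (diagMul d B) → d i * B i j ≡ d j * - B j i
    rescaled-skew d DB-skew = trans (DB-skew i j) (ℤ.neg-distribʳ-* (d j) (B j i))

  adjacent⇒≢0 : IsSkewSymmetrizable B → Adjacent B i j → B i j ≢ 0ℤ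
  adjacent⇒≢0 _ (inj₁ 0<Bij) = ≢-sym (ℤ.<⇒≢ 0<Bij)
  adjacent⇒≢0 (d , d-pos , DB-skew) (inj₂ 0<Bji) =
    ℤ.<⇒≢ (*-pos-≡⇒neg (d-pos i) (d-pos j) (rescaled-skew d DB-skew) (ℤ.neg-mono-< 0<Bji))

  ¬adjacent⇒≡0 : IsSkewSymmetrizable B → ¬ Adjacent B i j → B i j ≡ 0ℤ
  ¬adjacent⇒≡0 (d , d-pos , DB-skew) ¬adj with ℤ.<-cmp (B i j) 0ℤ
  ... | tri< Bij<0 _ _ = ⊥-elim (¬adj (inj₂ (ℤ.neg-cancel-<
          (*-pos-≡⇒neg (d-pos j) (d-pos i) (sym (rescaled-skew d DB-skew)) Bij<0))))
  ... | tri≈ _ Bij≡0 _ = Bij≡0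
  ... | tri> _ _ 0<Bij = ⊥-elim (¬adj (inj₁ 0<Bij))

module _ {B A : Matrix n} (B-skew : IsSkewSymmetrizable B)
         (companion : ∀ i j → i ≢ j → ∣ A i j ∣ ≡ ∣ B i j ∣) {i j : Fin n} (i≢j : i ≢ j) where

  companion-adjacent⇒≢0 : Adjacent B i j → A i j ≢ 0ℤ
  companion-adjacent⇒≢0 adj A≡0 =
    adjacent⇒≢0 B-skew adj (ℤ.∣i∣≡0⇒i≡0 (trans (sym (companion i j i≢j)) (cong ∣_∣ A≡0)))

  companion-¬adjacent⇒≡0 : ¬ Adjacent B i j → A i j ≡ 0ℤ
  companion-¬adjacent⇒≡0 ¬adj =
    ℤ.∣i∣≡0⇒i≡0 (trans (companion i j i≢j) (cong ∣_∣ (¬adjacent⇒≡0 B-skew ¬adj)))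

predMod : Fin (suc k) → Fin (suc k)
predMod fzero    = fromℕ _
predMod (fsuc c) = inject₁ c

sucMod-inject₁ : (c : Fin k) → sucMod (inject₁ c) ≡ fsuc c
sucMod-inject₁ {k} c = toℕ-injective (begin
  toℕ (sucMod (inject₁ c))      ≡⟨ toℕ-fromℕ< _ ⟩
  suc (toℕ (inject₁ c)) % suc k ≡⟨ cong (λ t → suc t % suc k) (toℕ-inject₁ c) ⟩
  suc (toℕ c) % suc k           ≡⟨ m<n⇒m%n≡m (ℕ.s≤s (toℕ<n c)) ⟩
  suc (toℕ c)                   ∎)
  where open ≡-Reasoning

sucMod-fromℕ : sucMod (fromℕ k) ≡ fzero
sucMod-fromℕ {k} = toℕ-injective (begin
  toℕ (sucMod (fromℕ k))      ≡⟨ toℕ-fromℕ< _ ⟩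
  suc (toℕ (fromℕ k)) % suc k ≡⟨ cong (λ t → suc t % suc k) (toℕ-fromℕ k) ⟩
  suc k % suc k               ≡⟨ n%n≡0 (suc k) ⟩
  0                           ∎)
  where open ≡-Reasoning

sucMod-predMod : (a : Fin (suc k)) → sucMod (predMod a) ≡ a
sucMod-predMod fzero    = sucMod-fromℕ
sucMod-predMod (fsuc c) = sucMod-inject₁ c

predMod-sucMod : (a : Fin (suc k)) → predMod (sucMod a) ≡ a
predMod-sucMod a with view a
... | ‵fromℕ      = cong predMod sucMod-fromℕ
... | ‵inject₁ c = cong predMod (sucMod-inject₁ c)

sucMod-≢ : (a : Fin (2 ℕ.+ k)) → sucMod a ≢ a
sucMod-≢ a with view a
... | ‵fromℕ      = 0≢1+n ∘ trans (sym sucMod-fromℕ)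
... | ‵inject₁ c = λ eq → ℕ.1+n≢n (trans (cong toℕ (trans (sym (sucMod-inject₁ c)) eq)) (toℕ-inject₁ c))

sucMod²-≢ : (a : Fin (3 ℕ.+ k)) → sucMod (sucMod a) ≢ a
sucMod²-≢ a with view a
... | ‵fromℕ = 0≢1+n ∘ suc-injective ∘ trans (sym ss-last)
  where
  ss-last : sucMod (sucMod (fromℕ _)) ≡ fsuc fzero
  ss-last = trans (cong sucMod sucMod-fromℕ) (sucMod-inject₁ fzero)
... | ‵inject₁ c with view c
...   | ‵fromℕ = 0≢1+n ∘ trans (sym ss-penultimate)
  where
  ss-penultimate : sucMod (sucMod (inject₁ (fromℕ _))) ≡ fzero
  ss-penultimate = trans (cong sucMod (sucMod-inject₁ (fromℕ _))) sucMod-fromℕ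
...   | ‵inject₁ c′ = λ eq → ℕ.m+1+n≢n 1 (begin
  2 ℕ.+ toℕ c′                      ≡⟨ cong toℕ (trans (sym ss-inner) eq) ⟩
  toℕ (inject₁ (inject₁ c′))        ≡⟨ toℕ-inject₁ (inject₁ c′) ⟩
  toℕ (inject₁ c′)                  ≡⟨ toℕ-inject₁ c′ ⟩
  toℕ c′                            ∎)
  where
  open ≡-Reasoning
  ss-inner : sucMod (sucMod (inject₁ (inject₁ c′))) ≡ fsuc (fsuc c′)
  ss-inner = trans (cong sucMod (sucMod-inject₁ (inject₁ c′))) (sucMod-inject₁ (fsuc c′))

pathSigns : (Fin n → ℤ) → Fin (suc n) → ℤ
pathSigns         f fzero    = 1ℤ
pathSigns {suc n} f (fsuc i) = σ (f fzero) * pathSigns (f ∘ fsuc) i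

pathSigns-unit : (f : Fin n → ℤ) (i : Fin (suc n)) → pathSigns f i * pathSigns f i ≡ 1ℤ
pathSigns-unit         f fzero    = refl
pathSigns-unit {suc n} f (fsuc i) = begin
  (s * t) * (s * t) ≡⟨ regroup s t ⟩
  (s * s) * (t * t) ≡⟨ cong₂ _*_ (σ-unit (f fzero)) (pathSigns-unit (f ∘ fsuc) i) ⟩
  1ℤ                ∎
  where
  open ≡-Reasoning
  s t : ℤ
  s = σ (f fzero)
  t = pathSigns (f ∘ fsuc) i
  regroup : ∀ a b → (a * b) * (a * b) ≡ (a * a) * (b * b)
  regroup = solve-∀

pathSigns-edge : (f : Fin n → ℤ) (c : Fin n) →
                 pathSigns f (inject₁ c) * pathSigns f (fsuc c) * f c ≡ + ∣ f c ∣
pathSigns-edge {suc n} f fzero = trans (drop-ones (σ (f fzero)) (f fzero)) (σ*i≡∣i∣ (f fzero))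
  where
  drop-ones : ∀ a b → 1ℤ * (a * 1ℤ) * b ≡ a * b
  drop-ones = solve-∀
pathSigns-edge {suc n} f (fsuc c) = begin
  (s * t) * (s * u) * y ≡⟨ regroup s t u y ⟩
  (s * s) * (t * u * y) ≡⟨ cong₂ _*_ (σ-unit (f fzero)) (pathSigns-edge (f ∘ fsuc) c) ⟩
  1ℤ * + ∣ y ∣          ≡⟨ ℤ.*-identityˡ (+ ∣ y ∣) ⟩
  + ∣ y ∣               ∎
  where
  open ≡-Reasoning
  s t u y : ℤ
  s = σ (f fzero)
  t = pathSigns (f ∘ fsuc) (inject₁ c)
  u = pathSigns (f ∘ fsuc) (fsuc c)
  y = f (fsuc c)
  regroup : ∀ a b c d → (a * b) * (a * c) * d ≡ (a * a) * (b * c * d)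
  regroup = solve-∀

pathSigns-last : (f : Fin n → ℤ) → pathSigns f (fromℕ n) * ∏ f ≡ ∏ (λ c → + ∣ f c ∣)
pathSigns-last {zero}  f = refl
pathSigns-last {suc n} f = begin
  (σ y * t) * (y * ∏ (f ∘ fsuc)) ≡⟨ regroup (σ y) t y (∏ (f ∘ fsuc)) ⟩
  (σ y * y) * (t * ∏ (f ∘ fsuc)) ≡⟨ cong₂ _*_ (σ*i≡∣i∣ y) (pathSigns-last (f ∘ fsuc)) ⟩
  + ∣ y ∣ * ∏ (λ c → + ∣ f (fsuc c) ∣) ∎
  where
  open ≡-Reasoning
  y t : ℤ
  y = f fzero
  t = pathSigns (f ∘ fsuc) (fromℕ n)
  regroup : ∀ a b c d → (a * b) * (c * d) ≡ (a * c) * (b * d)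
  regroup = solve-∀

module Switching (F : Fin (suc k) → ℤ) (F≢0 : ∀ a → F a ≢ 0ℤ) (¬∏F<0 : ¬ ∏ F < 0ℤ) where

  ε : Fin (suc k) → ℤ
  ε a = pathSigns F (inject₁ a)

  ε-unit : ∀ a → ε a * ε a ≡ 1ℤ
  ε-unit a = pathSigns-unit F (inject₁ a)

  -- pathSigns-last: the last sign times ∏ F is ∏ ∣F∣ > 0, while ∏ F ≥ 0.
  pathSigns-closed : pathSigns F (fromℕ (suc k)) ≡ 1ℤ
  pathSigns-closed = unit*pos⇒1 (pathSigns-unit F (fromℕ (suc k)))
    (subst (0ℤ <_) (sym (pathSigns-last F)) (∏-pos (≢0⇒0<∣∣ ∘ F≢0))) ¬∏F<0

  pathSigns-sucMod : ∀ a → pathSigns F (fsuc a) ≡ ε (sucMod a)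
  pathSigns-sucMod a with view a
  ... | ‵fromℕ      = trans pathSigns-closed (cong ε (sym sucMod-fromℕ))
  ... | ‵inject₁ c = cong ε (sym (sucMod-inject₁ c))

  ε-edge : ∀ a → 0ℤ < ε a * ε (sucMod a) * F a
  ε-edge a = subst (λ t → 0ℤ < ε a * t * F a) (pathSigns-sucMod a)
    (subst (0ℤ <_) (sym (pathSigns-edge F a)) (≢0⇒0<∣∣ (F≢0 a)))

extendByZero : {m : ℕ} → (Fin m → Fin n) → (Fin m → ℤ) → Fin n → ℤ
extendByZero v x i with any? (λ a → v a ≟ i)
... | yes (a , _) = x a
... | no _        = 0ℤ

module _ {m : ℕ} {v : Fin m → Fin n} (x : Fin m → ℤ) where

  extendByZero-image : Injective _≡_ _≡_ v → ∀ a → extendByZero v x (v a) ≡ x a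
  extendByZero-image v-inj a with any? (λ b → v b ≟ v a)
  ... | yes (b , vb≡va) = cong x (v-inj vb≡va)
  ... | no ∄b           = ⊥-elim (∄b (a , refl))

  extendByZero-outside : ∀ {i} → ¬ (∃ λ a → v a ≡ i) → extendByZero v x i ≡ 0ℤ
  extendByZero-outside {i} ∄a with any? (λ b → v b ≟ i)
  ... | yes ∃a = ⊥-elim (∄a ∃a)
  ... | no _   = refl

module _ {A : Matrix n} {d : Fin n → ℤ}
         (A-diag : ∀ i → A i i ≡ + 2) (d-pos : PositiveDiagonal d) (DA-sym : IsSymmetric (diagMul d A))
         {v : Fin (3 ℕ.+ k) → Fin n} (v-inj : Injective _≡_ _≡_ v)
         (chordless : ∀ a b → a ≢ b → ¬ Consecutive a b → A (v a) (v b) ≡ 0ℤ)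
         {ε : Fin (3 ℕ.+ k) → ℤ} (ε-unit : ∀ a → ε a * ε a ≡ 1ℤ)
         (ε-edge : ∀ a → ε a * ε (sucMod a) * A (v a) (v (sucMod a)) < 0ℤ) where

  private
    x : Fin n → ℤ
    x = extendByZero v ε

    term : Fin (3 ℕ.+ k) → Fin n → ℤ
    term a j = x (v a) * diagMul d A (v a) j * x j

    edge-neg : ∀ {a b} → Consecutive a b → ε a * ε b * A (v a) (v b) < 0ℤ
    edge-neg {a} (inj₁ refl) = ε-edge a
    edge-neg {a} {b} (inj₂ refl) = *-pos-≡⇒neg (d-pos (v a)) (d-pos (v b)) DA-sym-scaled (ε-edge b)
      where
      open ≡-Reasoning
      pull : ∀ e f g h → g * (e * f * h) ≡ e * f * (g * h)
      pull = solve-∀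
      push : ∀ e f g h → e * f * (g * h) ≡ g * (f * e * h)
      push = solve-∀
      DA-sym-scaled : d (v a) * (ε a * ε b * A (v a) (v b)) ≡ d (v b) * (ε b * ε a * A (v b) (v a))
      DA-sym-scaled = begin
        d (v a) * (ε a * ε b * A (v a) (v b)) ≡⟨ pull (ε a) (ε b) (d (v a)) (A (v a) (v b)) ⟩
        ε a * ε b * (d (v a) * A (v a) (v b)) ≡⟨ cong (ε a * ε b *_) (DA-sym (v a) (v b)) ⟩
        ε a * ε b * (d (v b) * A (v b) (v a)) ≡⟨ push (ε a) (ε b) (d (v b)) (A (v b) (v a)) ⟩
        d (v b) * (ε b * ε a * A (v b) (v a)) ∎

    term-cycle : ∀ a b → term a (v b) ≡ d (v a) * (ε a * ε b * A (v a) (v b))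
    term-cycle a b = begin
      x (v a) * (d (v a) * A (v a) (v b)) * x (v b)
        ≡⟨ cong₂ (λ s t → s * (d (v a) * A (v a) (v b)) * t)
                 (extendByZero-image ε v-inj a) (extendByZero-image ε v-inj b) ⟩
      ε a * (d (v a) * A (v a) (v b)) * ε b
        ≡⟨ regroup (ε a) (ε b) (d (v a)) (A (v a) (v b)) ⟩
      d (v a) * (ε a * ε b * A (v a) (v b)) ∎
      where
      open ≡-Reasoning
      regroup : ∀ e f g h → e * (g * h) * f ≡ g * (e * f * h)
      regroup = solve-∀

    term-self : ∀ a → term a (v a) ≡ d (v a) * + 2
    term-self a = trans (term-cycle a a) (cong (d (v a) *_) (cong₂ _*_ (ε-unit a) (A-diag (v a))))

    term-neighbour : ∀ {a b} → Consecutive a b → term a (v b) ≤ - d (v a)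
    term-neighbour {a} {b} a~b =
      ℤ.≤-trans (ℤ.≤-reflexive (term-cycle a b)) (pos*neg≤neg (d-pos (v a)) (edge-neg a~b))

    term-far : ∀ a j → j ≢ v a → j ≢ v (sucMod a) → j ≢ v (predMod a) → term a j ≤ 0ℤ
    term-far a j = far (any? (λ b → v b ≟ j))
      where
      open ≡-Reasoning
      vanish : ∀ g e f → g * (e * f * 0ℤ) ≡ 0ℤ
      vanish = solve-∀
      far : ∀ {j} → Dec (∃ λ b → v b ≡ j) → j ≢ v a → j ≢ v (sucMod a) → j ≢ v (predMod a) → term a j ≤ 0ℤ
      far (yes (b , refl)) b≢a b≢sa b≢pa = ℤ.≤-reflexive (begin
        term a (v b)                          ≡⟨ term-cycle a b ⟩
        d (v a) * (ε a * ε b * A (v a) (v b)) ≡⟨ cong (λ t → d (v a) * (ε a * ε b * t)) (chordless a b a≢b ¬a~b) ⟩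
        d (v a) * (ε a * ε b * 0ℤ)            ≡⟨ vanish (d (v a)) (ε a) (ε b) ⟩
        0ℤ                                    ∎)
        where
        a≢b : a ≢ b
        a≢b = b≢a ∘ cong v ∘ sym
        ¬a~b : ¬ Consecutive a b
        ¬a~b (inj₁ b≡sa) = b≢sa (cong v b≡sa)
        ¬a~b (inj₂ a≡sb) = b≢pa (cong v (trans (sym (predMod-sucMod b)) (cong predMod (sym a≡sb))))
      far {j} (no ∄b) _ _ _ = ℤ.≤-reflexive (begin
        x (v a) * diagMul d A (v a) j * x j ≡⟨ cong (x (v a) * diagMul d A (v a) j *_) (extendByZero-outside ε ∄b) ⟩
        x (v a) * diagMul d A (v a) j * 0ℤ  ≡⟨ ℤ.*-zeroʳ (x (v a) * diagMul d A (v a) j) ⟩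
        0ℤ                                  ∎)

    row-on-cycle : ∀ a → ∑ (term a) ≤ 0ℤ
    row-on-cycle a = ℤ.≤-trans
      (∑-≤-three-points a≢sa a≢pa sa≢pa (ℤ.≤-reflexive (term-self a))
        (term-neighbour (inj₁ refl)) (term-neighbour (inj₂ (sym (sucMod-predMod a)))) (term-far a))
      (ℤ.≤-reflexive (cancel (d (v a))))
      where
      cancel : ∀ g → g * + 2 + - g + - g ≡ 0ℤ
      cancel = solve-∀
      a≢sa : v a ≢ v (sucMod a)
      a≢sa = sucMod-≢ a ∘ sym ∘ v-inj
      a≢pa : v a ≢ v (predMod a)
      a≢pa eq = sucMod-≢ a (trans (cong sucMod (v-inj eq)) (sucMod-predMod a))
      sa≢pa : v (sucMod a) ≢ v (predMod a)
      sa≢pa eq = sucMod²-≢ a (trans (cong sucMod (v-inj eq)) (sucMod-predMod a))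

    row-off-cycle : ∀ {i} → ¬ (∃ λ a → v a ≡ i) → ∑ (λ j → x i * diagMul d A i j * x j) ≤ 0ℤ
    row-off-cycle {i} ∄a = ∑-nonpos (λ j → ℤ.≤-reflexive (begin
      x i * diagMul d A i j * x j  ≡⟨ cong (λ t → t * diagMul d A i j * x j) (extendByZero-outside ε ∄a) ⟩
      0ℤ * diagMul d A i j * x j   ≡⟨ cong (_* x j) (ℤ.*-zeroˡ (diagMul d A i j)) ⟩
      0ℤ * x j                     ≡⟨ ℤ.*-zeroˡ (x j) ⟩
      0ℤ                           ∎))
      where open ≡-Reasoning

    row-nonpos : ∀ i → ∑ (λ j → x i * diagMul d A i j * x j) ≤ 0ℤ
    row-nonpos i = row (any? (λ a → v a ≟ i))
      where
      row : ∀ {i} → Dec (∃ λ a → v a ≡ i) → ∑ (λ j → x i * diagMul d A i j * x j) ≤ 0ℤ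
      row (yes (a , refl)) = row-on-cycle a
      row (no ∄a)          = row-off-cycle ∄a

  ¬positiveDefinite : ¬ IsPositiveDefinite (diagMul d A)
  ¬positiveDefinite DA-posdef =
    ℤ.<-irrefl refl (ℤ.<-≤-trans (DA-posdef x (v fzero , x≢0)) (∑-nonpos row-nonpos))
    where
    x≢0 : x (v fzero) ≢ 0ℤ
    x≢0 x≡0 with trans (sym (ε-unit fzero))
                       (cong (λ t → t * t) (trans (sym (extendByZero-image ε v-inj fzero)) x≡0))
    ... | ()

proposition1p4 : (n : ℕ) (B A : Matrix n) → IsSkewSymmetrizable B → IsQuasiCartanCompanion A B → IsPositiveQuasiCartan A → (Z : ChordlessCycle B) → cycleProduct A Z < 0ℤ
proposition1p4 n B A B-skew (_ , companion) (A-diag , d , d-pos , DA-sym , DA-posdef) Z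
  with cycleProduct A Z <? 0ℤ
... | yes negative = negative
... | no ¬negative =
  ⊥-elim (¬positiveDefinite A-diag d-pos DA-sym distinct chordless {ε} ε-unit A-edge<0 DA-posdef)
  where
  open ChordlessCycle Z

  chordless : ∀ a b → a ≢ b → ¬ Consecutive a b → A (vertex a) (vertex b) ≡ 0ℤ
  chordless a b a≢b ¬a~b = companion-¬adjacent⇒≡0 {A = A} B-skew companion (a≢b ∘ distinct)
                             (¬a~b ∘ Equivalence.to (induced a b))

  edge≢0 : ∀ a → - A (vertex a) (vertex (sucMod a)) ≢ 0ℤ
  edge≢0 a -A≡0 = companion-adjacent⇒≢0 {A = A} B-skew companion (sucMod-≢ a ∘ sym ∘ distinct)
                    (Equivalence.from (induced a (sucMod a)) (inj₁ refl))
                    (trans (sym (ℤ.neg-involutive _)) (cong -_ -A≡0))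

  open Switching (λ a → - A (vertex a) (vertex (sucMod a))) edge≢0 ¬negative

  A-edge<0 : ∀ a → ε a * ε (sucMod a) * A (vertex a) (vertex (sucMod a)) < 0ℤ
  A-edge<0 a = ℤ.neg-cancel-< (subst (0ℤ <_) (sym (ℤ.neg-distribʳ-* (ε a * ε (sucMod a)) A-edge)) (ε-edge a))
    where
    A-edge : ℤ
    A-edge = A (vertex a) (vertex (sucMod a))
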